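{- Let $k \ge 3$ be an odd integer and let $D$ be a strongly connected $k$-quasi-transitive digraph. If $v \in V(D)$ satisfies $\Delta^+_D \ge d^+(v) > \Delta^+_D - \frac{k-1}{2}$, then $v$ is a $(k+1)$-king of $D$.
   Context: All digraphs are finite, without loops and without multiple arcs in the same direction; paths are directed. $d(u,v)$ is the length of a shortest directed $uv$-path ($d(v,v)=0$). A vertex $v$ is an $r$-king of $D$ if $d(v,u) \le r$ for every $u \in V(D)$. $d^+(x)$ is the out-degree of $x$ and $\Delta^+_D$ is the maximum out-degree in $D$. $D$ is $k$-quasi-transitive if for every directed path $(v_0, \dots, v_k)$ of length $k$, $(v_0,v_k) \in A(D)$ or $(v_k,v_0) \in A(D)$. -}

module Defs where

open import Data.Nat using (ℕ; zero; suc; _+_; _≤_; _⊔_)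
open import Data.Bool using (Bool; true; false; T)
open import Data.Fin using (Fin; inject₁) renaming (suc to fsuc)
open import Data.Fin.Properties using (all?)
open import Data.List using (List; map; foldr; filter; length)
open import Data.List.Base using (allFin)
open import Data.Product using (Σ; ∃; _×_; _,_)
open import Data.Sum using (_⊎_)
open import Function.Definitions using (Injective)
open import Relation.Binary.PropositionalEquality using (_≡_)
open import Relation.Nullary.Decidable using (Dec)

record Digraph (n : ℕ) : Set where
  field
    adj     : Fin n → Fin n → Bool
    loopless : ∀ v → adj v v ≡ false

open Digraph public

Arc : ∀ {n} → Digraph n → Fin n → Fin n → Set
Arc D u v = T (adj D u v)

data Walk {n : ℕ} (D : Digraph n) : Fin n → Fin n → ℕ → Set where
  here : ∀ {u} → Walk D u u 0
  step : ∀ {u w v ℓ} → Arc D u w → Walk D w v ℓ → Walk D u v (suc ℓ)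

-- d(u,v) ≤ r : there is a directed uv-walk of length at most r
-- (equivalently a uv-path of length at most r)
DistLe : ∀ {n} → Digraph n → Fin n → Fin n → ℕ → Set
DistLe D u v r = Σ ℕ λ ℓ → ℓ ≤ r × Walk D u v ℓ

StronglyConnected : ∀ {n} → Digraph n → Set
StronglyConnected D = ∀ u v → Σ ℕ λ ℓ → Walk D u v ℓ

IsKing : ∀ {n} → Digraph n → ℕ → Fin n → Set
IsKing D r v = ∀ u → DistLe D v u r

IsPath : ∀ {n} → Digraph n → (k : ℕ) → (Fin (suc k) → Fin n) → Set
IsPath D k p = Injective _≡_ _≡_ p × (∀ (i : Fin k) → Arc D (p (inject₁ i)) (p (fsuc i)))

QuasiTransitive : ∀ {n} → ℕ → Digraph n → Set
QuasiTransitive {n} k D = ∀ (p : Fin (suc k) → Fin n) → IsPath D k p →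
  Arc D (p Data.Fin.zero) (p (Data.Fin.fromℕ k)) ⊎ Arc D (p (Data.Fin.fromℕ k)) (p Data.Fin.zero)

outDeg : ∀ {n} → Digraph n → Fin n → ℕ
outDeg {n} D x = length (filter (λ y → Data.Bool._≟_ (adj D x y) true) (allFin n))

maxOutDeg : ∀ {n} → Digraph n → ℕ
maxOutDeg {n} D = foldr _⊔_ 0 (map (outDeg D) (allFin n))

-- If v is not a (k+1)-king, shorten walks from v until the first k + 3 vertices
-- x₀ … x_{k+2} of one of them are distinct, carry no forward chord, and no
-- out-neighbour of x₀ dominates x_{k+1}. Quasi-transitivity on x₀ … x_k gives the
-- arc x_k → x₀, so C = x₀ … x_k is a cycle of even length k + 1. A k-path that
-- starts at x_{k+2} (or at x_{k+1} x_{k+2}) and then runs along C must close into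
-- an arc, and the absence of shortcuts forces that arc to leave the start. Pushing
-- this around C, x_{k+2} dominates every even-indexed vertex of C, and then x_{k+1}
-- dominates every out-neighbour of x₀ as well as x_{k+2}, x₃, x₅, …, x_{k−2}, none
-- of which x₀ dominates. Hence d⁺(x_{k+1}) ≥ d⁺(x₀) + (k − 1)/2, contradicting the
-- degree assumption on x₀ = v.
module Submission where

open import Defs
open import Data.Bool using (Bool; true; false; T; T?; _∨_; if_then_else_)
open import Data.Bool.Properties using (T-∨) renaming (_≟_ to _≟ᵇ_)
open import Data.Empty using (⊥; ⊥-elim)
open import Data.Fin using (Fin; toℕ; inject₁) renaming (zero to fzero; suc to fsuc)
import Data.Fin.Properties as Fin
open import Data.List using (List; []; _∷_; length; filter; foldr; map; allFin)
open import Data.List.Membership.Propositional using (_∈_)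
open import Data.List.Membership.Propositional.Properties using (∈-allFin)
open import Data.List.Relation.Unary.Any using (here; there)
open import Data.Nat using (ℕ; zero; suc; pred; _+_; _*_; _∸_; _≤_; _<_; _⊔_; z≤n; s≤s; _≤?_; _<?_; NonZero)
open import Data.Nat.DivMod
open import Data.Nat.Induction using (<-rec)
open import Data.Nat.Properties
open import Data.Nat.Tactic.RingSolver using (solve-∀)
open import Data.Product using (Σ; ∃; _×_; _,_; proj₂)
open import Data.Sum as Sum using (_⊎_; inj₁; inj₂)
open import Data.Unit using (tt)
open import Function.Base using (_∘_; id)
open import Function.Bundles using (Equivalence)
open import Function.Definitions using (Injective)
open import Relation.Binary.Definitions using (DecidableEquality; tri<; tri≈; tri>)
open import Relation.Binary.PropositionalEquality
open import Relation.Nullary using (¬_; Dec; yes; no)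
open import Relation.Nullary.Decidable using (⌊_⌋; toWitness; fromWitness; _×-dec_)

module Counting {a} {A : Set a} (_≟_ : DecidableEquality A) where

  count : (A → Bool) → List A → ℕ
  count f xs = length (filter (λ y → f y ≟ᵇ true) xs)

  count-∷ : ∀ f y ys → count f (y ∷ ys) ≡ (if f y then suc (count f ys) else count f ys)
  count-∷ f y ys with f y
  ... | true  = refl
  ... | false = refl

  count-mono : ∀ {f g} → (∀ y → T (f y) → T (g y)) → ∀ xs → count f xs ≤ count g xs
  count-mono f⇒g [] = z≤n
  count-mono {f} {g} f⇒g (y ∷ ys)
    rewrite count-∷ f y ys | count-∷ g y ys with f y | g y | f⇒g y
  ... | true  | true  | _   = s≤s (count-mono f⇒g ys)
  ... | true  | false | gy  = ⊥-elim (gy tt)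
  ... | false | true  | _   = m≤n⇒m≤1+n (count-mono f⇒g ys)
  ... | false | false | _   = count-mono f⇒g ys

  count-mono-< : ∀ {f g z xs} → (∀ y → T (f y) → T (g y)) →
                 z ∈ xs → T (g z) → ¬ T (f z) → count f xs < count g xs
  count-mono-< {f} {g} {z} {z ∷ ys} f⇒g (here refl) gz ¬fz
    rewrite count-∷ f z ys | count-∷ g z ys with f z | g z
  ... | true  | _    = ⊥-elim (¬fz tt)
  ... | false | true = s≤s (count-mono f⇒g ys)
  count-mono-< {f} {g} {z} {y ∷ ys} f⇒g (there z∈ys) gz ¬fz
    rewrite count-∷ f y ys | count-∷ g y ys with f y | g y | f⇒g y
  ... | true  | true  | _   = s≤s (count-mono-< f⇒g z∈ys gz ¬fz)
  ... | true  | false | gy  = ⊥-elim (gy tt)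
  ... | false | true  | _   = m≤n⇒m≤1+n (count-mono-< f⇒g z∈ys gz ¬fz)
  ... | false | false | _   = count-mono-< f⇒g z∈ys gz ¬fz

  _∪｛_｝ : (A → Bool) → A → A → Bool
  (f ∪｛ z ｝) y = f y ∨ ⌊ y ≟ z ⌋

  ∪-inj₁ : ∀ f z y → T (f y) → T ((f ∪｛ z ｝) y)
  ∪-inj₁ f z y fy = Equivalence.from (T-∨ {f y}) (inj₁ fy)

  ∪-new : ∀ f z → T ((f ∪｛ z ｝) z)
  ∪-new f z = Equivalence.from (T-∨ {f z}) (inj₂ (fromWitness {a? = z ≟ z} refl))

  ∪-cases : ∀ f z y → T ((f ∪｛ z ｝) y) → T (f y) ⊎ y ≡ z
  ∪-cases f z y p = Sum.map₂ (toWitness {a? = y ≟ z}) (Equivalence.to T-∨ p)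

  count-mono-+ : ∀ {f g xs} r (e : Fin r → A) → Injective _≡_ _≡_ e →
                 (∀ i → e i ∈ xs) → (∀ i → T (g (e i))) → (∀ i → ¬ T (f (e i))) →
                 (∀ y → T (f y) → T (g y)) → count f xs + r ≤ count g xs
  count-mono-+ {f} {g} {xs} zero e _ _ _ _ f⇒g =
    subst (_≤ count g xs) (sym (+-identityʳ _)) (count-mono f⇒g xs)
  count-mono-+ {f} {g} {xs} (suc r) e e-inj e∈xs ge ¬fe f⇒g = begin
    count f xs + suc r    ≡⟨ +-suc (count f xs) r ⟩
    suc (count f xs) + r  ≤⟨ +-monoˡ-≤ r (count-mono-< (∪-inj₁ f e₀) (e∈xs fzero) (∪-new f e₀) (¬fe fzero)) ⟩
    count f′ xs + r       ≤⟨ count-mono-+ r (e ∘ fsuc) (Fin.suc-injective ∘ e-inj) (e∈xs ∘ fsuc) (ge ∘ fsuc) ¬f′e f′⇒g ⟩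
    count g xs            ∎
    where
    open ≤-Reasoning
    e₀ = e fzero
    f′ = f ∪｛ e₀ ｝
    ¬f′e : ∀ i → ¬ T (f′ (e (fsuc i)))
    ¬f′e i p with ∪-cases f e₀ _ p
    ... | inj₁ fe = ¬fe (fsuc i) fe
    ... | inj₂ eq with e-inj eq
    ...   | ()
    f′⇒g : ∀ y → T (f′ y) → T (g y)
    f′⇒g y p with ∪-cases f e₀ y p
    ... | inj₁ fy   = f⇒g y fy
    ... | inj₂ refl = ge fzero

≤-foldr-⊔ : ∀ {a} {A : Set a} (h : A → ℕ) {y xs} → y ∈ xs → h y ≤ foldr _⊔_ 0 (map h xs)
≤-foldr-⊔ h {xs = x ∷ xs} (here refl) = m≤m⊔n (h x) _
≤-foldr-⊔ h {xs = x ∷ xs} (there y∈xs) = ≤-trans (≤-foldr-⊔ h y∈xs) (m≤n⊔m (h x) _)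

outDeg≤maxOutDeg : ∀ {n} (D : Digraph n) y → outDeg D y ≤ maxOutDeg D
outDeg≤maxOutDeg D y = ≤-foldr-⊔ (outDeg D) (∈-allFin y)

[m+n]%o≡[m+p]%o⇒n≡p : ∀ {o} m {n p} → n < suc o → p < suc o →
                       (m + n) % suc o ≡ (m + p) % suc o → n ≡ p
[m+n]%o≡[m+p]%o⇒n≡p {o} m {n} {p} n<o p<o eq = begin
  n                              ≡⟨ recover n<o ⟩
  ((m + n) % suc o + r) % suc o  ≡⟨ cong (λ s → (s + r) % suc o) eq ⟩
  ((m + p) % suc o + r) % suc o  ≡⟨ recover p<o ⟨
  p                              ∎
  where
  open ≡-Reasoning
  r = m * o % suc o
  shift : ∀ n m o → n + m * suc o ≡ m + n + m * o
  shift = solve-∀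
  -- Adding m·o ≡ −m (mod o + 1) to m + n recovers n.
  recover : ∀ {n} → n < suc o → n ≡ ((m + n) % suc o + r) % suc o
  recover {n} n<o = begin
    n                           ≡⟨ m<n⇒m%n≡m n<o ⟨
    n % suc o                   ≡⟨ [m+kn]%n≡m%n n m (suc o) ⟨
    (n + m * suc o) % suc o     ≡⟨ cong (_% suc o) (shift n m o) ⟩
    (m + n + m * o) % suc o     ≡⟨ %-distribˡ-+ (m + n) (m * o) (suc o) ⟩
    ((m + n) % suc o + r) % suc o ∎

m≤n⇒m%n≡1⇒m≡1 : ∀ {m n} .{{_ : NonZero n}} → m ≤ n → m % n ≡ 1 → m ≡ 1
m≤n⇒m%n≡1⇒m≡1 {m} {n} m≤n m%n≡1 with m≤n⇒m<n∨m≡n m≤n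
... | inj₁ m<n  = trans (sym (m<n⇒m%n≡m m<n)) m%n≡1
... | inj₂ refl = ⊥-elim (0≢1+n (trans (sym (n%n≡0 n)) m%n≡1))

module Walks {n} {D : Digraph n} where

  _++ʷ_ : ∀ {u v w p q} → Walk D u v p → Walk D v w q → Walk D u w (p + q)
  here      ++ʷ W′ = W′
  step uw W ++ʷ W′ = step uw (W ++ʷ W′)

  snocʷ : ∀ {u v w ℓ} → Walk D u v ℓ → Arc D v w → Walk D u w (suc ℓ)
  snocʷ here        vw = step vw here
  snocʷ (step uw W) vw = step uw (snocʷ W vw)

  -- Beyond the end of W, vertex W stays at its last vertex.
  vertex : ∀ {u v ℓ} → Walk D u v ℓ → ℕ → Fin n
  vertex {u} here        _       = u
  vertex {u} (step _ _)  zero    = u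
  vertex     (step _ W)  (suc i) = vertex W i

  vertex-zero : ∀ {u v ℓ} (W : Walk D u v ℓ) → vertex W 0 ≡ u
  vertex-zero here       = refl
  vertex-zero (step _ _) = refl

  vertex-arc : ∀ {u v ℓ} (W : Walk D u v ℓ) {i} → i < ℓ → Arc D (vertex W i) (vertex W (suc i))
  vertex-arc (step {u} uw W) {zero}  _         = subst (Arc D u) (sym (vertex-zero W)) uw
  vertex-arc (step uw W)     {suc i} (s≤s i<ℓ) = vertex-arc W i<ℓ

  takeʷ : ∀ {u v ℓ} (W : Walk D u v ℓ) i → i ≤ ℓ → Walk D u (vertex W i) i
  takeʷ here        zero    _        = here
  takeʷ (step _ _)  zero    _        = here
  takeʷ (step uw W) (suc i) (s≤s i≤ℓ) = step uw (takeʷ W i i≤ℓ)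

  dropʷ : ∀ {u v ℓ} (W : Walk D u v ℓ) i → i ≤ ℓ → Walk D (vertex W i) v (ℓ ∸ i)
  dropʷ here        zero    _        = here
  dropʷ (step uw W) zero    _        = step uw W
  dropʷ (step _ W)  (suc i) (s≤s i≤ℓ) = dropʷ W i i≤ℓ

  ShorterWalk : Fin n → Fin n → ℕ → Set
  ShorterWalk u v ℓ = Σ ℕ λ ℓ′ → ℓ′ < ℓ × Walk D u v ℓ′

  shortcut : ∀ {u v ℓ b p} (W : Walk D u v ℓ) → b ≤ ℓ → p < b →
             Walk D u (vertex W b) p → ShorterWalk u v ℓ
  shortcut {ℓ = ℓ} {b} {p} W b≤ℓ p<b W′ = p + (ℓ ∸ b) , shorter , W′ ++ʷ dropʷ W b b≤ℓ
    where
    shorter : p + (ℓ ∸ b) < ℓ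
    shorter = subst (p + (ℓ ∸ b) <_) (m+[n∸m]≡n b≤ℓ) (+-monoˡ-< (ℓ ∸ b) p<b)

qt-path : ∀ {n k} {D : Digraph n} → QuasiTransitive k D → (p : ℕ → Fin n) →
          (∀ {a b} → a ≤ k → b ≤ k → p a ≡ p b → a ≡ b) →
          (∀ {i} → i < k → Arc D (p i) (p (suc i))) →
          Arc D (p 0) (p k) ⊎ Arc D (p k) (p 0)
qt-path {k = k} {D} qt p p-inj p-arc =
  subst (λ m → Arc D (p 0) (p m) ⊎ Arc D (p m) (p 0)) (Fin.toℕ-fromℕ k)
    (qt (p ∘ toℕ) (injective , arcs))
  where
  injective : Injective _≡_ _≡_ (p ∘ toℕ)
  injective {i} {i′} eq = Fin.toℕ-injective (p-inj (≤-pred (Fin.toℕ<n i)) (≤-pred (Fin.toℕ<n i′)) eq)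
  arcs : ∀ (i : Fin k) → Arc D (p (toℕ (inject₁ i))) (p (suc (toℕ i)))
  arcs i = subst (λ m → Arc D (p m) (p (suc (toℕ i)))) (sym (Fin.toℕ-inject₁ i)) (p-arc (Fin.toℕ<n i))

-- The consequences of x₀ … x_ℓ being an initial segment of a shortest walk
-- that the argument uses.
record ShortcutFree {n} (D : Digraph n) (ℓ : ℕ) (x : ℕ → Fin n) : Set where
  field
    arc       : ∀ {i} → i < ℓ → Arc D (x i) (x (suc i))
    injective : ∀ {a b} → a ≤ ℓ → b ≤ ℓ → x a ≡ x b → a ≡ b
    noChord   : ∀ {a b} → suc a < b → b ≤ ℓ → ¬ Arc D (x a) (x b)
    noBypass  : ∀ {y} → Arc D (x 0) y → ¬ Arc D y (x (pred ℓ))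

module OddQuasiTransitive {n} {D : Digraph n} (j : ℕ) (qt : QuasiTransitive (3 + 2 * j) D)
                          {x : ℕ → Fin n} (sf : ShortcutFree D (5 + 2 * j) x) where

  open ShortcutFree sf

  k K N : ℕ
  k = 3 + 2 * j
  K = suc k
  N = suc K

  k<N : k < N
  k<N = n≤1+n K

  k≤N : k ≤ N
  k≤N = <⇒≤ k<N

  InjectiveUpToN : (ℕ → Fin n) → Set
  InjectiveUpToN z = ∀ {a b} → a ≤ N → b ≤ N → z a ≡ z b → a ≡ b

  qt-reindexed : ∀ z → InjectiveUpToN z → (σ : ℕ → ℕ) → (∀ {i} → i ≤ k → σ i ≤ N) →
                 (∀ {a b} → a ≤ k → b ≤ k → σ a ≡ σ b → a ≡ b) →
                 (∀ {i} → i < k → Arc D (z (σ i)) (z (σ (suc i)))) →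
                 Arc D (z (σ 0)) (z (σ k)) ⊎ Arc D (z (σ k)) (z (σ 0))
  qt-reindexed z z-inj σ σ≤N σ-inj =
    qt-path {D = D} qt (z ∘ σ) (λ a≤k b≤k → σ-inj a≤k b≤k ∘ z-inj (σ≤N a≤k) (σ≤N b≤k))

  back-arc : ∀ {a} → a ≤ 2 → Arc D (x (k + a)) (x a)
  back-arc {a} a≤2 = Sum.[ ⊥-elim ∘ noChord (+-monoˡ-≤ a (s≤s (s≤s z≤n))) (bound ≤-refl) , id ]′
    (qt-reindexed x injective (_+ a) bound (λ _ _ → +-cancelʳ-≡ a _ _) (λ i<k → arc (bound i<k)))
    where
    bound : ∀ {i} → i ≤ k → i + a ≤ N
    bound {i} i≤k = ≤-trans (+-mono-≤ i≤k a≤2) (≤-reflexive (+-comm k 2))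

  x_k→x₀ : Arc D (x k) (x 0)
  x_k→x₀ = subst (λ m → Arc D (x m) (x 0)) (+-identityʳ k) (back-arc z≤n)

  x_N→x₂ : Arc D (x N) (x 2)
  x_N→x₂ = subst (λ m → Arc D (x m) (x 2)) (+-comm k 2) (back-arc ≤-refl)

  X : ℕ → Fin n
  X t = x (t % K)

  %K≤k : ∀ t → t % K ≤ k
  %K≤k t = ≤-pred (m%n<n t K)

  X-step : ∀ t → Arc D (X t) (X (suc t))
  X-step t = subst (Arc D (X t) ∘ x) (sym suc-%) (cycle-next (%K≤k t))
    where
    suc-% : suc t % K ≡ (t % K + 1) % K
    suc-% = trans (cong (_% K) (+-comm 1 t)) (%-distribˡ-+ t 1 K)
    cycle-next : ∀ {r} → r ≤ k → Arc D (x r) (x ((r + 1) % K))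
    cycle-next {r} r≤k with m≤n⇒m<n∨m≡n r≤k
    ... | inj₁ r<k  = subst (Arc D (x r) ∘ x) (sym (trans (cong (_% K) (+-comm r 1)) (m<n⇒m%n≡m (s≤s r<k))))
                        (arc (≤-trans r<k k≤N))
    ... | inj₂ refl = subst (Arc D (x k) ∘ x) (sym (trans (cong (_% K) (+-comm k 1)) (n%n≡0 K))) x_k→x₀

  off-cycle : ∀ {s} → k < s → ∀ t → s ≢ t % K
  off-cycle k<s t s≡ = <⇒≱ k<s (subst (_≤ k) (sym s≡) (%K≤k t))

  X↛x_N : ∀ t → ¬ Arc D (X t) (x N)
  X↛x_N t = noChord (s≤s (s≤s (%K≤k t))) ≤-refl

  X-window-injective : ∀ c {a b} → a ≤ k → b ≤ k → (c + a) % K ≡ (c + b) % K → a ≡ b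
  X-window-injective c a≤k b≤k = [m+n]%o≡[m+p]%o⇒n≡p c (s≤s a≤k) (s≤s b≤k)

  -- Quasi-transitivity on the path x_N, X (2 + c), …, X (c + K).
  step-back : ∀ c → Arc D (x N) (X (2 + c)) → Arc D (x N) (X c)
  step-back c x_N→ =
    Sum.[ subst (Arc D (x N) ∘ x) end , ⊥-elim ∘ X↛x_N (2 + c + (2 + 2 * j)) ]′ (qt-reindexed x injective σ σ≤N σ-inj arcs)
    where
    σ : ℕ → ℕ
    σ zero    = N
    σ (suc t) = (2 + c + t) % K
    σ≤N : ∀ {i} → i ≤ k → σ i ≤ N
    σ≤N {zero}  _ = ≤-refl
    σ≤N {suc t} _ = ≤-trans (%K≤k (2 + c + t)) k≤N
    σ-inj : ∀ {a b} → a ≤ k → b ≤ k → σ a ≡ σ b → a ≡ b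
    σ-inj {zero}  {zero}  _   _   _  = refl
    σ-inj {zero}  {suc b} _   _   eq = ⊥-elim (off-cycle k<N (2 + c + b) eq)
    σ-inj {suc a} {zero}  _   _   eq = ⊥-elim (off-cycle k<N (2 + c + a) (sym eq))
    σ-inj {suc a} {suc b} a<k b<k eq = cong suc (X-window-injective (2 + c) {a} {b} (<⇒≤ a<k) (<⇒≤ b<k) eq)
    arcs : ∀ {i} → i < k → Arc D (x (σ i)) (x (σ (suc i)))
    arcs {zero}  _ = subst (Arc D (x N) ∘ x ∘ (_% K)) (sym (+-identityʳ (2 + c))) x_N→
    arcs {suc t} _ = subst (Arc D (X (2 + c + t)) ∘ x ∘ (_% K)) (sym (+-suc (2 + c) t)) (X-step (2 + c + t))
    around : ∀ c j → 2 + c + (2 + 2 * j) ≡ c + (4 + 2 * j)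
    around = solve-∀
    end : (2 + c + (2 + 2 * j)) % K ≡ c % K
    end = trans (cong (_% K) (around c j)) ([m+n]%n≡m%n c K)

  steps-back : ∀ c d → Arc D (x N) (X (c + 2 * d)) → Arc D (x N) (X c)
  steps-back c zero    x_N→ = subst (Arc D (x N) ∘ X) (+-identityʳ c) x_N→
  steps-back c (suc d) x_N→ = step-back c (steps-back (2 + c) d (subst (Arc D (x N) ∘ X) (shift c d) x_N→))
    where
    shift : ∀ c d → c + 2 * suc d ≡ 2 + c + 2 * d
    shift = solve-∀

  even-out : ∀ q → Arc D (x N) (X (2 * q))
  even-out q = steps-back (2 * q) (1 + q * (1 + j))
    (subst (Arc D (x N) ∘ x) (sym (trans (cong (_% K) (wind q j)) ([m+kn]%n≡m%n 2 q K))) x_N→x₂)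
    where
    wind : ∀ q j → 2 * q + 2 * (1 + q * (1 + j)) ≡ 2 + q * (4 + 2 * j)
    wind = solve-∀

  -- Quasi-transitivity on the path z_K, z_N, z (c mod K), …, z ((c + k − 2) mod K).
  lasso : ∀ z → InjectiveUpToN z → ∀ c → Arc D (z K) (z N) → Arc D (z N) (z (c % K)) →
          (∀ {t} → t < 1 + 2 * j → Arc D (z ((c + t) % K)) (z ((c + suc t) % K))) →
          Arc D (z K) (z ((c + (1 + 2 * j)) % K)) ⊎ Arc D (z ((c + (1 + 2 * j)) % K)) (z K)
  lasso z z-inj c z_K→z_N z_N→ run = qt-reindexed z z-inj σ σ≤N σ-inj arcs
    where
    σ : ℕ → ℕ
    σ zero          = K
    σ (suc zero)    = N
    σ (suc (suc t)) = (c + t) % K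
    σ≤N : ∀ {i} → i ≤ k → σ i ≤ N
    σ≤N {zero}          _ = n≤1+n K
    σ≤N {suc zero}      _ = ≤-refl
    σ≤N {suc (suc t)}   _ = ≤-trans (%K≤k (c + t)) k≤N
    σ-inj : ∀ {a b} → a ≤ k → b ≤ k → σ a ≡ σ b → a ≡ b
    σ-inj {zero}        {zero}        _ _ _  = refl
    σ-inj {zero}        {suc zero}    _ _ eq = ⊥-elim (1+n≢n (sym eq))
    σ-inj {zero}        {suc (suc b)} _ _ eq = ⊥-elim (off-cycle ≤-refl (c + b) eq)
    σ-inj {suc zero}    {zero}        _ _ eq = ⊥-elim (1+n≢n eq)
    σ-inj {suc zero}    {suc zero}    _ _ _  = refl
    σ-inj {suc zero}    {suc (suc b)} _ _ eq = ⊥-elim (off-cycle k<N (c + b) eq)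
    σ-inj {suc (suc a)} {zero}        _ _ eq = ⊥-elim (off-cycle ≤-refl (c + a) (sym eq))
    σ-inj {suc (suc a)} {suc zero}    _ _ eq = ⊥-elim (off-cycle k<N (c + a) (sym eq))
    σ-inj {suc (suc a)} {suc (suc b)} a≤k b≤k eq =
      cong (suc ∘ suc) (X-window-injective c {a} {b} (≤-trans (n≤1+n a) (≤-trans (n≤1+n (suc a)) a≤k))
                                                      (≤-trans (n≤1+n b) (≤-trans (n≤1+n (suc b)) b≤k)) eq)
    arcs : ∀ {i} → i < k → Arc D (z (σ i)) (z (σ (suc i)))
    arcs {zero}          _                 = z_K→z_N
    arcs {suc zero}      _                 = subst (Arc D (z N) ∘ z ∘ (_% K)) (sym (+-identityʳ c)) z_N→
    arcs {suc (suc t)}   (s≤s (s≤s t<)) = run t<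

  odd-out : ∀ {i} → i < j → Arc D (x K) (x (3 + 2 * i))
  odd-out {i} i<j =
    Sum.[ subst (Arc D (x K) ∘ x) end , ⊥-elim ∘ noChord chord (n≤1+n K) ∘ subst (λ m → Arc D (x m) (x K)) end ]′
      (lasso x injective (6 + 2 * i) (arc {K} ≤-refl) x_N→X run)
    where
    double : ∀ i → 2 * (3 + i) ≡ 6 + 2 * i
    double = solve-∀
    x_N→X : Arc D (x N) (X (6 + 2 * i))
    x_N→X = subst (Arc D (x N) ∘ X) (double i) (even-out (3 + i))
    run : ∀ {t} → t < 1 + 2 * j → Arc D (X (6 + 2 * i + t)) (X (6 + 2 * i + suc t))
    run {t} _ = subst (Arc D (X (6 + 2 * i + t)) ∘ X) (sym (+-suc (6 + 2 * i) t)) (X-step (6 + 2 * i + t))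
    around : ∀ i j → 6 + 2 * i + (1 + 2 * j) ≡ 3 + 2 * i + (4 + 2 * j)
    around = solve-∀
    2i+2≤2j : 2 + 2 * i ≤ 2 * j
    2i+2≤2j = subst (_≤ 2 * j) (*-suc 2 i) (*-monoʳ-≤ 2 i<j)
    chord : suc (3 + 2 * i) < K
    chord = s≤s (s≤s (s≤s (s≤s (≤-trans (n≤1+n _) 2i+2≤2j))))
    end : (6 + 2 * i + (1 + 2 * j)) % K ≡ 3 + 2 * i
    end = begin
      (6 + 2 * i + (1 + 2 * j)) % K  ≡⟨ cong (_% K) (around i j) ⟩
      (3 + 2 * i + K) % K            ≡⟨ [m+n]%n≡m%n (3 + 2 * i) K ⟩
      (3 + 2 * i) % K                ≡⟨ m<n⇒m%n≡m (<-trans (n<1+n _) chord) ⟩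
      3 + 2 * i                      ∎
      where open ≡-Reasoning

  -- The lasso on x₀ … x_N with x₁ replaced by the out-neighbour y of x₀ ends in y.
  module _ {y} (x₀→y : Arc D (x 0) y) where

    x′ : ℕ → Fin n
    x′ zero          = x 0
    x′ (suc zero)    = y
    x′ (suc (suc a)) = x (suc (suc a))

    x′-agrees : ∀ {a} → a ≢ 1 → x′ a ≡ x a
    x′-agrees {zero}        _   = refl
    x′-agrees {suc zero}    a≢1 = ⊥-elim (a≢1 refl)
    x′-agrees {suc (suc a)} _   = refl

    y-index : ∀ {a} → a ≤ N → x a ≡ y → a ≡ 1
    y-index {zero}        _   x₀≡y = ⊥-elim (subst T (loopless D (x 0)) (subst (Arc D (x 0)) (sym x₀≡y) x₀→y))
    y-index {suc zero}    _   _    = refl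
    y-index {suc (suc a)} a≤N xa≡y = ⊥-elim (noChord (s≤s (s≤s z≤n)) a≤N (subst (Arc D (x 0)) (sym xa≡y) x₀→y))

    x′-injective : InjectiveUpToN x′
    x′-injective {zero}        {zero}        _   _   _  = refl
    x′-injective {zero}        {suc zero}    a≤N _   eq = y-index a≤N eq
    x′-injective {zero}        {suc (suc b)} a≤N b≤N eq = injective a≤N b≤N eq
    x′-injective {suc zero}    {zero}        _   b≤N eq = sym (y-index b≤N (sym eq))
    x′-injective {suc zero}    {suc zero}    _   _   _  = refl
    x′-injective {suc zero}    {suc (suc b)} _   b≤N eq = sym (y-index b≤N (sym eq))
    x′-injective {suc (suc a)} {zero}        a≤N b≤N eq = injective a≤N b≤N eq
    x′-injective {suc (suc a)} {suc zero}    a≤N _   eq = y-index a≤N eq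
    x′-injective {suc (suc a)} {suc (suc b)} a≤N b≤N eq = injective a≤N b≤N eq

    x′-on-cycle : ∀ {s} → 1 < s → s ≤ K → x′ (s % K) ≡ X s
    x′-on-cycle 1<s s≤K = x′-agrees (λ s%K≡1 → <⇒≢ 1<s (sym (m≤n⇒m%n≡1⇒m≡1 s≤K s%K≡1)))

    x′-run : ∀ {t} → t < 1 + 2 * j → Arc D (x′ ((4 + t) % K)) (x′ ((4 + suc t) % K))
    x′-run {t} (s≤s t≤2j) with m≤n⇒m<n∨m≡n {4 + t} {K} (s≤s (s≤s (s≤s (s≤s t≤2j))))
    ... | inj₁ 4+t<K = subst₂ (Arc D) (sym (x′-on-cycle 1<4+t (<⇒≤ 4+t<K))) (sym (x′-on-cycle (m<n⇒m<1+n 1<4+t) 4+t<K))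
                         (X-step (4 + t))
      where
      1<4+t : 1 < 4 + t
      1<4+t = s≤s (s≤s z≤n)
    ... | inj₂ 4+t≡K = subst (λ s → Arc D (x′ (s % K)) (x′ (suc s % K))) (sym 4+t≡K)
                         (subst₂ (λ a b → Arc D (x′ a) (x′ b)) (sym (n%n≡0 K)) (sym ([m+n]%n≡m%n 1 K)) x₀→y)

    x_K→y : Arc D (x K) y
    x_K→y = Sum.[ subst (Arc D (x K) ∘ x′) end , ⊥-elim ∘ noBypass x₀→y ∘ subst (λ s → Arc D (x′ s) (x K)) end ]′
      (lasso x′ x′-injective 4 (arc {K} ≤-refl)
             (subst (Arc D (x N)) (sym (x′-on-cycle (s≤s (s≤s z≤n)) (s≤s (s≤s (s≤s (s≤s z≤n)))))) (even-out 2))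
             x′-run)
      where
      end : (4 + (1 + 2 * j)) % K ≡ 1
      end = [m+n]%n≡m%n 1 K

  open Counting (Fin._≟_ {n})

  extra : Fin (suc j) → Fin n
  extra fzero    = x N
  extra (fsuc i) = x (3 + 2 * toℕ i)

  odd<K : ∀ (i : Fin j) → 3 + 2 * toℕ i < K
  odd<K i = s≤s (s≤s (s≤s (s≤s (*-monoʳ-≤ 2 (<⇒≤ (Fin.toℕ<n i))))))

  odd<N : ∀ (i : Fin j) → 3 + 2 * toℕ i < N
  odd<N i = <-trans (odd<K i) ≤-refl

  extra-injective : Injective _≡_ _≡_ extra
  extra-injective {fzero}  {fzero}   _  = refl
  extra-injective {fzero}  {fsuc i}  eq = ⊥-elim (<-irrefl (injective (<⇒≤ (odd<N i)) ≤-refl (sym eq)) (odd<N i))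
  extra-injective {fsuc i} {fzero}   eq = ⊥-elim (<-irrefl (injective (<⇒≤ (odd<N i)) ≤-refl eq) (odd<N i))
  extra-injective {fsuc i} {fsuc i′} eq = cong fsuc (Fin.toℕ-injective (*-cancelˡ-≡ (toℕ i) (toℕ i′) 2
    (+-cancelˡ-≡ 3 _ _ (injective (<⇒≤ (odd<N i)) (<⇒≤ (odd<N i′)) eq))))

  extra-out-of-x_K : ∀ i → Arc D (x K) (extra i)
  extra-out-of-x_K fzero    = arc {K} ≤-refl
  extra-out-of-x_K (fsuc i) = odd-out (Fin.toℕ<n i)

  extra-not-out-of-x₀ : ∀ i → ¬ Arc D (x 0) (extra i)
  extra-not-out-of-x₀ fzero    = noChord (s≤s (s≤s z≤n)) ≤-refl
  extra-not-out-of-x₀ (fsuc i) = noChord (s≤s (s≤s z≤n)) (<⇒≤ (odd<N i))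

  outDeg-gap : outDeg D (x 0) + suc j ≤ outDeg D (x K)
  outDeg-gap = count-mono-+ (suc j) extra extra-injective (λ i → ∈-allFin (extra i))
                 extra-out-of-x_K extra-not-out-of-x₀ (λ y → x_K→y {y})

module _ {n} {D : Digraph n} where

  open Walks {D = D}

  shorter⊎shortcutFree : ∀ {u v ℓ m} (W : Walk D u v ℓ) → 2 < m → suc m ≤ ℓ →
                         ShorterWalk u v ℓ ⊎ ShortcutFree D (suc m) (vertex W)
  shorter⊎shortcutFree {u} {v} {ℓ} {m} W 2<m m<ℓ = decide repeat? chord? bypass?
    where
    x = vertex W

    Repeat Chord Bypass : Set
    Repeat = ∃ λ b → b < suc (suc m) × ∃ λ a → a < b × x a ≡ x b
    Chord  = ∃ λ b → b < suc (suc m) × ∃ λ a → a < b × suc a < b × Arc D (x a) (x b)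
    Bypass = ∃ λ y → Arc D (x 0) y × Arc D y (x m)

    repeat? : Dec Repeat
    repeat? = anyUpTo? (λ b → anyUpTo? (λ a → x a Fin.≟ x b) b) (suc (suc m))
    chord? : Dec Chord
    chord? = anyUpTo? (λ b → anyUpTo? (λ a → suc a <? b ×-dec T? (adj D (x a) (x b))) b) (suc (suc m))
    bypass? : Dec Bypass
    bypass? = Fin.any? (λ y → T? (adj D (x 0) y) ×-dec T? (adj D y (x m)))

    within : ∀ {b} → b ≤ suc m → b ≤ ℓ
    within b≤sm = ≤-trans b≤sm m<ℓ

    injective : ¬ Repeat → ∀ {a b} → a ≤ suc m → b ≤ suc m → x a ≡ x b → a ≡ b
    injective ¬repeat {a} {b} a≤sm b≤sm eq with <-cmp a b
    ... | tri< a<b _ _ = ⊥-elim (¬repeat (b , s≤s b≤sm , a , a<b , eq))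
    ... | tri≈ _ a≡b _ = a≡b
    ... | tri> _ _ b<a = ⊥-elim (¬repeat (a , s≤s a≤sm , b , b<a , sym eq))

    decide : Dec Repeat → Dec Chord → Dec Bypass → ShorterWalk u v ℓ ⊎ ShortcutFree D (suc m) x
    decide (yes (b , s≤s b≤sm , a , a<b , xa≡xb)) _ _ =
      inj₁ (shortcut W (within b≤sm) a<b
             (subst (λ t → Walk D u t a) xa≡xb (takeʷ W a (within (≤-trans (<⇒≤ a<b) b≤sm)))))
    decide (no _) (yes (b , s≤s b≤sm , a , a<b , sa<b , xa→xb)) _ =
      inj₁ (shortcut W (within b≤sm) sa<b (snocʷ (takeʷ W a (within (≤-trans (<⇒≤ a<b) b≤sm))) xa→xb))
    decide (no _) (no _) (yes (y , x₀→y , y→xm)) =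
      inj₁ (shortcut W (<⇒≤ m<ℓ) 2<m (step (subst (λ s → Arc D s y) (vertex-zero W) x₀→y) (step y→xm here)))
    decide (no ¬repeat) (no ¬chord) (no ¬bypass) = inj₂ record
      { arc       = λ i<sm → vertex-arc W (within i<sm)
      ; injective = injective ¬repeat
      ; noChord   = λ {a} {b} sa<b b≤sm xa→xb → ¬chord (b , s≤s b≤sm , a , <⇒≤ sa<b , sa<b , xa→xb)
      ; noBypass  = λ x₀→y y→xm → ¬bypass (_ , x₀→y , y→xm)
      }

module _ {n} {D : Digraph n} (j : ℕ) (qt : QuasiTransitive (3 + 2 * j) D) {v : Fin n}
         (deg : 2 * maxOutDeg D < 2 * outDeg D v + (2 + 2 * j)) where

  open Walks {D = D}

  no-shortcutFree-from-v : ∀ {x} → ShortcutFree D (5 + 2 * j) x → x 0 ≡ v → ⊥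
  no-shortcutFree-from-v {x} sf x₀≡v = <⇒≱ deg (begin
    2 * outDeg D v + (2 + 2 * j)     ≡⟨ cong (λ w → 2 * outDeg D w + (2 + 2 * j)) (sym x₀≡v) ⟩
    2 * outDeg D (x 0) + (2 + 2 * j) ≡⟨ double (outDeg D (x 0)) j ⟩
    2 * (outDeg D (x 0) + suc j)     ≤⟨ *-monoʳ-≤ 2 (≤-trans (OddQuasiTransitive.outDeg-gap j qt sf) (outDeg≤maxOutDeg D _)) ⟩
    2 * maxOutDeg D                  ∎)
    where
    open ≤-Reasoning
    double : ∀ d j → 2 * d + (2 + 2 * j) ≡ 2 * (d + suc j)
    double = solve-∀

  king : StronglyConnected D → IsKing D (4 + 2 * j) v
  king sc u = <-rec (λ ℓ → Walk D v u ℓ → DistLe D v u (4 + 2 * j)) shorten _ (proj₂ (sc v u))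
    where
    shorten : ∀ ℓ → (∀ {ℓ′} → ℓ′ < ℓ → Walk D v u ℓ′ → DistLe D v u (4 + 2 * j)) →
              Walk D v u ℓ → DistLe D v u (4 + 2 * j)
    shorten ℓ shorter W with ℓ ≤? 4 + 2 * j
    ... | yes ℓ≤ = ℓ , ℓ≤ , W
    ... | no ℓ≰ with shorter⊎shortcutFree W (s≤s (s≤s (s≤s z≤n))) (≰⇒> ℓ≰)
    ...   | inj₁ (ℓ′ , ℓ′<ℓ , W′) = shorter ℓ′<ℓ W′
    ...   | inj₂ sf               = ⊥-elim (no-shortcutFree-from-v sf (vertex-zero W))

1+2[1+m]≡3+2m : ∀ m → 1 + 2 * suc m ≡ 3 + 2 * m
1+2[1+m]≡3+2m = solve-∀

mainTheorem18 : ∀ (k : ℕ) → 3 ≤ k → (∃ λ m → k ≡ 1 + 2 * m) →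
    ∀ {n} (D : Digraph n) → StronglyConnected D → QuasiTransitive k D →
    ∀ (v : Fin n) → outDeg D v ≤ maxOutDeg D →
    2 * maxOutDeg D < 2 * outDeg D v + (k ∸ 1) →
    IsKing D (suc k) v
mainTheorem18 k 3≤k (zero , refl) = ⊥-elim (<⇒≱ 3≤k (s≤s z≤n))
mainTheorem18 k 3≤k (suc j , k≡) D sc qt v _ deg with trans k≡ (1+2[1+m]≡3+2m j)
... | refl = king j qt deg sc
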